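{- Let an instance of DDP be given, and let $G$ be the interval graph of its delivery time intervals, with maximum degree $\Delta$. Let $m$ be the number of drones opened by the greedy algorithm GreedyAlgoForDDP on this instance. Then at least $m-\Delta-1$ of these drones have total assigned energy cost at least $B/2$.
   Context: DDP instance: deliveries $j=1,\dots,n$, each with a closed delivery time interval $I_j=[t_j^L,t_j^R]$ and cost $0<c_j\le B$, where $B>0$ is the battery budget of identical drones. A set of intervals is compatible if they are pairwise disjoint, and feasible if it is compatible and its total cost is at most $B$. The interval graph $G$ has one vertex per interval and an edge between two vertices iff the corresponding intervals intersect. GreedyAlgoForDDP: sort the deliveries by non-decreasing launch time $t_j^L$; process them in this order; for the current delivery $j$, among the already opened drones whose current assignment together with $I_j$ is feasible (i.e. remaining capacity $\ge c_j$ and $I_j$ disjoint from all intervals already assigned to that drone), choose one with maximum remaining capacity and assign $j$ to it; if no opened drone is feasible for $j$, open a new drone and assign $j$ to it. The output is the number $m$ of opened drones and their assignments.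
   Formalization: The delivery times $t_j^L$, $t_j^R$, the costs $c_j$ and the battery budget $B$ are rational. -}

module Defs where

open import Data.Nat as ℕ using (ℕ; _⊔_)
open import Data.Fin using (Fin; _≟_)
open import Data.List using (List; []; _∷_; [_]; _++_; length; filter; map; foldr; lookup; updateAt; allFin)
open import Data.List.Relation.Unary.All using (All)
open import Data.List.Relation.Unary.Linked using (Linked)
open import Data.List.Relation.Binary.Permutation.Propositional using (_↭_)
open import Data.Rational using (ℚ; 0ℚ; _+_; _-_; _*_; _≤_; _<_; ½)
open import Data.Rational.Properties using (_≤?_; _<?_)
open import Data.Product using (_×_; Σ)
open import Data.Sum using (_⊎_)
open import Relation.Nullary using (¬_; Dec; yes; no)
open import Relation.Nullary.Decidable using (_×-dec_; ¬?)
open import Relation.Binary.PropositionalEquality using (_≡_; _≢_)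

record DDP (n : ℕ) : Set where
  field
    B    : ℚ
    tL   : Fin n → ℚ
    tR   : Fin n → ℚ
    c    : Fin n → ℚ
    B-pos   : 0ℚ < B
    L≤R     : ∀ j → tL j ≤ tR j
    c-pos   : ∀ j → 0ℚ < c j
    c≤B     : ∀ j → c j ≤ B

module _ {n : ℕ} (I : DDP n) where
  open DDP I

  Intersect : Fin n → Fin n → Set
  Intersect j k = (tL j ≤ tR k) × (tL k ≤ tR j)

  intersect? : ∀ j k → Dec (Intersect j k)
  intersect? j k = (tL j ≤? tR k) ×-dec (tL k ≤? tR j)

  Disjoint : Fin n → Fin n → Set
  Disjoint j k = ¬ Intersect j k

  degree : Fin n → ℕ
  degree j = length (filter (λ k → ¬? (k ≟ j) ×-dec intersect? j k) (allFin n))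

  maxDegree : ℕ
  maxDegree = foldr _⊔_ 0 (map degree (allFin n))

  -- a drone is represented by the list of deliveries assigned to it
  Drone : Set
  Drone = List (Fin n)

  load : Drone → ℚ
  load d = foldr _+_ 0ℚ (map c d)

  remaining : Drone → ℚ
  remaining d = B - load d

  FeasibleFor : Drone → Fin n → Set
  FeasibleFor d j = (c j ≤ remaining d) × All (Disjoint j) d

  -- one step of GreedyAlgoForDDP processing delivery j
  -- (ties among max-remaining-capacity drones broken arbitrarily)
  data Step : List Drone → Fin n → List Drone → Set where
    assign : ∀ {s j} (i : Fin (length s))
           → FeasibleFor (lookup s i) j
           → (∀ (i' : Fin (length s)) → FeasibleFor (lookup s i') j
                → remaining (lookup s i') ≤ remaining (lookup s i))
           → Step s j (updateAt s i (λ d → d ++ [ j ]))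
    open-new : ∀ {s j}
           → All (λ d → ¬ FeasibleFor d j) s
           → Step s j (s ++ [ [ j ] ])

  data Run : List Drone → List (Fin n) → List Drone → Set where
    done : ∀ {s} → Run s [] s
    step : ∀ {s s' s'' j js} → Step s j s' → Run s' js s'' → Run s (j ∷ js) s''

  SortedOrder : List (Fin n) → Set
  SortedOrder order = (order ↭ allFin n) × Linked (λ i j → tL i ≤ tL j) order

  GreedyOutput : List Drone → Set
  GreedyOutput drones = Σ (List (Fin n)) (λ order → SortedOrder order × Run [] order drones)

  heavyCount : List Drone → ℕ
  heavyCount drones = length (filter (λ d → (½ * B) ≤? load d) drones)

-- Call a drone light if its load is below B/2. Assigning a delivery to an opened
-- drone never creates a light drone, so light drones only appear when a drone is
-- opened for a delivery j with c_j < B/2. At that moment every opened drone is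
-- infeasible for j; a light one has room for j, hence contains an interval
-- meeting I_j, and these intervals are distinct neighbours of j in G. So at most
-- Δ drones were light before, and at most Δ + 1 afterwards. The bound therefore
-- holds for every processing order and every choice among feasible drones.
module Submission where

open import Defs
open import Data.Nat using (ℕ; _≤_; _∸_)
open import Data.List using (List; length)

open import Data.Nat using (suc; _+_; _<_; _⊔_; z≤n; s≤s)
import Data.Nat.Properties as ℕ
open import Data.Fin as Fin using (Fin; _≟_)
open import Data.List using ([]; _∷_; [_]; _++_; concat; filter; foldr; updateAt; allFin)
import Data.List.Properties as List
open import Data.List.Relation.Unary.All using (All; []; _∷_)
open import Data.List.Relation.Unary.All.Properties using (¬All⇒Any¬)
import Data.List.Relation.Unary.All as All
open import Data.List.Relation.Unary.Any using (here; there)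
import Data.List.Relation.Unary.Any as Any
open import Data.List.Relation.Unary.AllPairs using (_∷_)
open import Data.List.Relation.Unary.Unique.Propositional using (Unique)
open import Data.List.Relation.Unary.Unique.Propositional.Properties using (allFin⁺)
open import Data.List.Membership.Propositional using (_∈_; _∉_; find)
open import Data.List.Membership.Propositional.Properties
  using (∈-allFin; ∈-map⁺; ∈-filter⁺; ∈-length; ∈-++⁺ˡ; ∈-++⁺ʳ)
open import Data.List.Relation.Binary.Permutation.Propositional
  using (_↭_; ↭-sym; ↭-trans; ↭-reflexive; ↭⇒↭ₛ; module PermutationReasoning)
open import Data.List.Relation.Binary.Permutation.Propositional.Properties
  using (++⁺ˡ; ++⁺ʳ; ++-comm; filter-↭; ↭-length)
import Data.List.Relation.Binary.Permutation.Setoid.Properties as Permutationₛ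
open import Data.Rational using (½; -_) renaming (_+_ to _+ℚ_; _-_ to _-ℚ_; _*_ to _*ℚ_; _≤_ to _≤ℚ_; _<_ to _<ℚ_)
import Data.Rational.Properties as ℚ
open import Algebra.Properties.Group ℚ.+-0-group using (//-rightDividesʳ)
open import Data.Product using (_×_; _,_)
open import Data.Empty using (⊥-elim)
open import Relation.Nullary using (¬_; yes; no)
open import Relation.Nullary.Decidable using (¬?; _×-dec_; decidable-stable)
open import Function using (_∘_)
open import Relation.Unary using (Pred; Decidable)
open import Relation.Unary.Properties using (∁?)
open import Relation.Binary.PropositionalEquality
  using (_≡_; refl; sym; trans; cong; subst; setoid)

module _ {A : Set} where

  Unique-resp-↭ : ∀ {xs ys : List A} → xs ↭ ys → Unique xs → Unique ys
  Unique-resp-↭ p = Permutationₛ.Unique-resp-↭ (setoid A) (↭⇒↭ₛ p)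

  Unique-++-∷⇒∉ : ∀ (xs : List A) {y ys} → Unique (xs ++ y ∷ ys) → y ∉ xs
  Unique-++-∷⇒∉ (x ∷ xs) (x≢ ∷ _) (here refl) = All.lookup x≢ (∈-++⁺ʳ xs (here refl)) refl
  Unique-++-∷⇒∉ (x ∷ xs) (_ ∷ u) (there y∈xs) = Unique-++-∷⇒∉ xs u y∈xs

  concat-updateAt-++ : ∀ (xss : List (List A)) i ys →
                       concat (updateAt xss i (_++ ys)) ↭ concat xss ++ ys
  concat-updateAt-++ (xs ∷ xss) Fin.zero ys = begin
    (xs ++ ys) ++ concat xss   ≡⟨ List.++-assoc xs ys (concat xss) ⟩
    xs ++ ys ++ concat xss     ↭⟨ ++⁺ˡ xs (++-comm ys (concat xss)) ⟩
    xs ++ concat xss ++ ys     ≡⟨ List.++-assoc xs (concat xss) ys ⟨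
    (xs ++ concat xss) ++ ys   ∎
    where open PermutationReasoning
  concat-updateAt-++ (xs ∷ xss) (Fin.suc i) ys = begin
    xs ++ concat (updateAt xss i (_++ ys))  ↭⟨ ++⁺ˡ xs (concat-updateAt-++ xss i ys) ⟩
    xs ++ concat xss ++ ys                  ≡⟨ List.++-assoc xs (concat xss) ys ⟨
    (xs ++ concat xss) ++ ys                ∎
    where open PermutationReasoning

  module _ {ℓ} {P : Pred A ℓ} (P? : Decidable P) where

    length-filter+∁ : ∀ xs → length xs ≡ length (filter P? xs) + length (filter (∁? P?) xs)
    length-filter+∁ [] = refl
    length-filter+∁ (x ∷ xs) with P? x
    ... | yes _ = cong suc (length-filter+∁ xs)
    ... | no  _ = trans (cong suc (length-filter+∁ xs)) (sym (ℕ.+-suc _ _))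

    length-filter-++ : ∀ xs ys →
                       length (filter P? (xs ++ ys)) ≡ length (filter P? xs) + length (filter P? ys)
    length-filter-++ xs ys = trans (cong length (List.filter-++ P? xs ys)) (List.length-++ (filter P? xs))

    length-filter-updateAt : ∀ {f : A → A} → (∀ {x} → P (f x) → P x) → ∀ xs i →
                             length (filter P? (updateAt xs i f)) ≤ length (filter P? xs)
    length-filter-updateAt {f} P∘f⇒P (x ∷ xs) Fin.zero with P? (f x) | P? x
    ... | yes _  | yes _  = ℕ.≤-refl
    ... | yes Pfx | no ¬Px = ⊥-elim (¬Px (P∘f⇒P Pfx))
    ... | no _   | yes _  = ℕ.n≤1+n _
    ... | no _   | no _   = ℕ.≤-refl
    length-filter-updateAt P∘f⇒P (x ∷ xs) (Fin.suc i) with P? x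
    ... | yes _ = s≤s (length-filter-updateAt P∘f⇒P xs i)
    ... | no  _ = length-filter-updateAt P∘f⇒P xs i

∈⇒≤foldr-⊔ : ∀ {m ms} → m ∈ ms → m ≤ foldr _⊔_ 0 ms
∈⇒≤foldr-⊔ {ms = m ∷ ms} (here refl) = ℕ.m≤m⊔n m _
∈⇒≤foldr-⊔ {ms = m ∷ ms} (there p) = ℕ.m≤n⇒m≤o⊔n m (∈⇒≤foldr-⊔ p)

module _ {n : ℕ} (I : DDP n) where
  open DDP I

  Heavy : Pred (Drone I) _
  Heavy d = ½ *ℚ B ≤ℚ load I d

  heavy? : Decidable Heavy
  heavy? d = ½ *ℚ B ℚ.≤? load I d

  lightCount : List (Drone I) → ℕ
  lightCount ds = length (filter (∁? heavy?) ds)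

  Adjacent : Fin n → Pred (Fin n) _
  Adjacent j k = ¬ k ≡ j × Intersect I j k

  -- Stated exactly as in degree, so that degree I j is definitionally
  -- length (filter (adjacent? j) (allFin n)).
  adjacent? : ∀ j → Decidable (Adjacent j)
  adjacent? j k = ¬? (k ≟ j) ×-dec intersect? I j k

  degree≤maxDegree : ∀ j → degree I j ≤ maxDegree I
  degree≤maxDegree j = ∈⇒≤foldr-⊔ (∈-map⁺ (degree I) (∈-allFin j))

  load-++-[] : ∀ d j → load I d ≤ℚ load I (d ++ [ j ])
  load-++-[] []      j = ℚ.≤-trans (ℚ.<⇒≤ (c-pos j)) (ℚ.≤-reflexive (sym (ℚ.+-identityʳ (c j))))
  load-++-[] (k ∷ d) j = ℚ.+-monoʳ-≤ (c k) (load-++-[] d j)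

  ½B+½B≡B : ½ *ℚ B +ℚ ½ *ℚ B ≡ B
  ½B+½B≡B = trans (sym (ℚ.*-distribʳ-+ B ½ ½)) (ℚ.*-identityˡ B)

  fits-light : ∀ {j d} → c j <ℚ ½ *ℚ B → load I d <ℚ ½ *ℚ B → c j ≤ℚ remaining I d
  fits-light {j} {d} cj<½B load<½B = ℚ.<⇒≤ (begin-strict
    c j                          ≡⟨ //-rightDividesʳ (load I d) (c j) ⟨
    c j +ℚ load I d -ℚ load I d  <⟨ ℚ.+-monoˡ-< (- load I d) sum<B ⟩
    B -ℚ load I d                ∎)
    where
    open ℚ.≤-Reasoning
    sum<B : c j +ℚ load I d <ℚ B
    sum<B = ℚ.<-≤-trans (ℚ.+-mono-< cj<½B load<½B) (ℚ.≤-reflexive ½B+½B≡B)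

  neighbour-in-light : ∀ {j d} → c j <ℚ ½ *ℚ B → ¬ Heavy d → j ∉ d → ¬ FeasibleFor I d j →
                       0 < length (filter (adjacent? j) d)
  neighbour-in-light {j} {d} cj<½B light j∉d infeasible =
    let (k , k∈d , j∩k) = find meets
    in ∈-length (∈-filter⁺ (adjacent? j) k∈d ((λ k≡j → j∉d (subst (_∈ d) k≡j k∈d)) , j∩k))
    where
    meets : Any.Any (Intersect I j) d
    meets = Any.map (decidable-stable (intersect? I j _))
      (¬All⇒Any¬ (λ k → ¬? (intersect? I j k)) d
        (λ disjoint → infeasible (fits-light {d = d} cj<½B (ℚ.≰⇒> light) , disjoint)))

  lightCount≤neighbours : ∀ {j} ds → c j <ℚ ½ *ℚ B → j ∉ concat ds →
                          All (λ d → ¬ FeasibleFor I d j) ds →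
                          lightCount ds ≤ length (filter (adjacent? j) (concat ds))
  lightCount≤neighbours [] _ _ [] = z≤n
  lightCount≤neighbours {j} (d ∷ ds) cj<½B j∉ (infeasible ∷ infeasibles)
    rewrite length-filter-++ (adjacent? j) d (concat ds)
    with heavy? d | lightCount≤neighbours ds cj<½B (j∉ ∘ ∈-++⁺ʳ d) infeasibles
  ... | yes heavy | rest rewrite List.filter-reject (∁? heavy?) {d} {ds} (λ light → light heavy)
    = ℕ.m≤n⇒m≤o+n _ rest
  ... | no light  | rest rewrite List.filter-accept (∁? heavy?) {d} {ds} light
    = ℕ.+-mono-≤ (neighbour-in-light cj<½B light (j∉ ∘ ∈-++⁺ˡ) infeasible) rest

  neighbours≤maxDegree : ∀ {j} xs ys → xs ++ ys ↭ allFin n →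
                         length (filter (adjacent? j) xs) ≤ maxDegree I
  neighbours≤maxDegree {j} xs ys xs++ys↭ = begin
    length (filter (adjacent? j) xs)                                     ≤⟨ ℕ.m≤m+n _ _ ⟩
    length (filter (adjacent? j) xs) + length (filter (adjacent? j) ys)  ≡⟨ length-filter-++ (adjacent? j) xs ys ⟨
    length (filter (adjacent? j) (xs ++ ys))                             ≡⟨ ↭-length (filter-↭ (adjacent? j) xs++ys↭) ⟩
    degree I j                                                           ≤⟨ degree≤maxDegree j ⟩
    maxDegree I                                                          ∎
    where open ℕ.≤-Reasoning

  Partition : List (Drone I) → List (Fin n) → Set
  Partition ds js = concat ds ++ js ↭ allFin n

  pending∉assigned : ∀ {ds j js} → Partition ds (j ∷ js) → j ∉ concat ds
  pending∉assigned {ds} p = Unique-++-∷⇒∉ (concat ds) (Unique-resp-↭ (↭-sym p) (allFin⁺ n))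

  concat-step : ∀ {ds j ds'} → Step I ds j ds' → concat ds' ↭ concat ds ++ [ j ]
  concat-step {ds} {j} (assign i _ _) = concat-updateAt-++ ds i [ j ]
  concat-step {ds} {j} (open-new _)   = ↭-reflexive (sym (List.concat-++ ds [ [ j ] ]))

  partition-step : ∀ {ds j ds' js} → Step I ds j ds' → Partition ds (j ∷ js) → Partition ds' js
  partition-step {ds} {j} {js = js} st p =
    ↭-trans (++⁺ʳ js (concat-step st)) (↭-trans (↭-reflexive (List.++-assoc (concat ds) [ j ] js)) p)

  lightCount≤maxDegree-before-opening : ∀ {ds j js} → Partition ds (j ∷ js) →
                                        All (λ d → ¬ FeasibleFor I d j) ds → ¬ Heavy [ j ] →
                                        lightCount ds ≤ maxDegree I
  lightCount≤maxDegree-before-opening {ds} {j} {js} p infeasibles light = ℕ.≤-trans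
    (lightCount≤neighbours ds cj<½B (pending∉assigned {ds} p) infeasibles)
    (neighbours≤maxDegree (concat ds) (j ∷ js) p)
    where
    cj<½B : c j <ℚ ½ *ℚ B
    cj<½B = subst (_<ℚ ½ *ℚ B) (ℚ.+-identityʳ (c j)) (ℚ.≰⇒> light)

  lightCount-step : ∀ {ds j ds' js} → Step I ds j ds' → Partition ds (j ∷ js) →
                    lightCount ds ≤ suc (maxDegree I) → lightCount ds' ≤ suc (maxDegree I)
  lightCount-step {ds} {j} (assign i _ _) _ bound = ℕ.≤-trans
    (length-filter-updateAt (∁? heavy?) (λ {d} light heavy → light (ℚ.≤-trans heavy (load-++-[] d j))) ds i)
    bound
  lightCount-step {ds} {j} (open-new infeasibles) p bound
    rewrite length-filter-++ (∁? heavy?) ds [ [ j ] ] with heavy? [ j ]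
  ... | yes heavy rewrite List.filter-reject (∁? heavy?) {[ j ]} {[]} (λ light → light heavy)
    = ℕ.≤-trans (ℕ.≤-reflexive (ℕ.+-identityʳ _)) bound
  ... | no light rewrite List.filter-accept (∁? heavy?) {[ j ]} {[]} light
    = ℕ.≤-trans (ℕ.≤-reflexive (ℕ.+-comm _ 1))
        (s≤s (lightCount≤maxDegree-before-opening {ds} p infeasibles light))

  lightCount-run : ∀ {ds js ds'} → Run I ds js ds' → Partition ds js →
                   lightCount ds ≤ suc (maxDegree I) → lightCount ds' ≤ suc (maxDegree I)
  lightCount-run done           _ bound = bound
  lightCount-run (step st run) p bound =
    lightCount-run run (partition-step st p) (lightCount-step st p bound)

lemma4p1 : ∀ {n : ℕ} (I : DDP n) (drones : List (Drone I))
           → GreedyOutput I drones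
           → length drones ∸ maxDegree I ∸ 1 ≤ heavyCount I drones
lemma4p1 I drones (_ , (order↭ , _) , run) = begin
  length drones ∸ Δ ∸ 1    ≡⟨ ℕ.∸-+-assoc (length drones) Δ 1 ⟩
  length drones ∸ (Δ + 1)  ≤⟨ ℕ.m≤n+o⇒m∸n≤o (length drones) (Δ + 1) drones≤ ⟩
  heavyCount I drones      ∎
  where
  open ℕ.≤-Reasoning
  Δ : ℕ
  Δ = maxDegree I
  drones≤ : length drones ≤ Δ + 1 + heavyCount I drones
  drones≤ = begin
    length drones                                  ≡⟨ length-filter+∁ (heavy? I) drones ⟩
    heavyCount I drones + lightCount I drones      ≤⟨ ℕ.+-monoʳ-≤ (heavyCount I drones) (lightCount-run I run order↭ z≤n) ⟩
    heavyCount I drones + suc Δ                    ≡⟨ ℕ.+-comm (heavyCount I drones) (suc Δ) ⟩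
    suc Δ + heavyCount I drones                    ≡⟨ cong (_+ heavyCount I drones) (ℕ.+-comm 1 Δ) ⟩
    Δ + 1 + heavyCount I drones                    ∎
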